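{- Every $2$-intersecting $5$-uniform hypergraph with at most $10$ edges has covering number at most $3$.
   Context: A hypergraph is $r$-uniform if every edge has exactly $r$ vertices, and $2$-intersecting if any two distinct edges share at least two vertices. The covering number is the minimum size of a set of vertices meeting every edge. Hypergraphs are finite and simple. -}

module Defs where

open import Data.Nat using (ℕ; _≤_)
open import Data.Fin using (Fin)
open import Data.Fin.Subset using (Subset; ∣_∣; _∩_; Nonempty)
open import Data.List using (List; length)
open import Data.List.Membership.Propositional using (_∈_)
open import Data.List.Relation.Unary.Unique.Propositional using (Unique)
open import Data.Product using (Σ; _×_)
open import Relation.Binary.PropositionalEquality using (_≡_)
open import Relation.Nullary using (¬_)

record Hypergraph (n : ℕ) : Set where
  field
    edges  : List (Subset n)
    simple : Unique edges
open Hypergraph public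

numEdges : ∀ {n} → Hypergraph n → ℕ
numEdges H = length (edges H)

Uniform : ∀ {n} → ℕ → Hypergraph n → Set
Uniform r H = ∀ e → e ∈ edges H → ∣ e ∣ ≡ r

TwoIntersecting : ∀ {n} → Hypergraph n → Set
TwoIntersecting H = ∀ e f → e ∈ edges H → f ∈ edges H → ¬ (e ≡ f) → 2 ≤ ∣ e ∩ f ∣

IsCover : ∀ {n} → Hypergraph n → Subset n → Set
IsCover H C = ∀ e → e ∈ edges H → Nonempty (e ∩ C)

CoveringNumberAtMost : ∀ {n} → Hypergraph n → ℕ → Set
CoveringNumberAtMost H k = Σ (Subset _) (λ C → IsCover H C × ∣ C ∣ ≤ k)

module Submission where

-- Fix an edge E. Any other edge F meets E in at least two vertices, so for a 2-subset P of E with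
-- P ≠ F ∩ E, the triple E ∖ P meets F. E has ten 2-subsets and there are at most nine other edges,
-- so some P differs from every F ∩ E, and E ∖ P is a cover of size 3. The pigeonhole step is carried
-- out in Fin 5, on the traces of the edges along an enumeration of E.

open import Defs
import Data.Bool.Properties as Bool
open import Data.Fin using (Fin; zero; suc; #_)
open import Data.Fin.Subset
  using (Subset; inside; outside; ⊥; ⁅_⁆; _∪_; _∩_; ∁; ∣_∣; _⊆_; Nonempty; Empty)
  renaming (_∈_ to _∈ₛ_)
open import Data.Fin.Subset.Properties
  using ( nonempty?; Empty-unique; ∣⊥∣≡0; ∣⁅x⁆∣≡1; ∣∁p∣≡n∸∣p∣; x∈⁅x⁆; x∈p∩q⁺; x∈p∩q⁻; x∈p∪q⁺
        ; p⊆q⇒∣p∣≤∣q∣; drop-∷-⊆; x∉p⇒x∈∁p; _∈?_)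
open import Data.List using (List; []; _∷_; length; map; filter)
open import Data.List.Membership.Propositional using (_∈_; _∉_)
open import Data.List.Membership.Propositional.Properties using (∈-filter⁺)
open import Data.List.Properties using (filter-notAll; length-map)
open import Data.List.Relation.Unary.All as All using (All; []; _∷_; all?)
open import Data.List.Relation.Unary.All.Properties using (map⁺; map⁻)
open import Data.List.Relation.Unary.AllPairs using (_∷_)
import Data.List.Relation.Unary.Any as Any
open import Data.List.Relation.Unary.Any using (here; there)
open import Data.List.Relation.Unary.Unique.Propositional using (Unique)
open import Data.List.Relation.Unary.Unique.DecPropositional using (unique?)
open import Data.Nat using (ℕ; _≤_; _<_; _+_; _∸_; _≟_; z≤n; s≤s)
open import Data.Nat.Properties using (≤-trans; ≤-reflexive; +-mono-≤; +-suc; m≤n⇒m≤1+n; n≮n; <⇒≢)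
open import Data.Product using (Σ; ∃; _×_; _,_)
open import Data.Sum using (inj₁; inj₂)
import Data.Vec as Vec
open import Data.Vec using ([]; _∷_; here; there)
open import Data.Vec.Properties using (≡-dec; []=⇒lookup; lookup⇒[]=; lookup∘tabulate)
open import Function using (_∘_)
open import Relation.Binary.Definitions using (DecidableEquality)
open import Relation.Binary.PropositionalEquality using (_≡_; _≢_; ≢-sym; refl; sym; trans; cong)
open import Relation.Nullary using (yes; no; ¬?; contradiction)
open import Relation.Nullary.Decidable using (from-yes)

private
  variable
    m n : ℕ

module _ {a} {A : Set a} (_≟ᴬ_ : DecidableEquality A) where
  open import Data.List.Membership.DecPropositional _≟ᴬ_ using () renaming (_∈?_ to _∈ᴸ?_)

  length<⇒∃∉ : ∀ {xs : List A} → Unique xs → ∀ ys → length ys < length xs → ∃ λ x → x ∈ xs × x ∉ ys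
  length<⇒∃∉ {x ∷ xs} (x≢xs ∷ xs!) ys (s≤s ∣ys∣≤∣xs∣) with x ∈ᴸ? ys
  ... | no x∉ys = x , here refl , x∉ys
  ... | yes x∈ys =
    let ys∖x     = filter (λ y → ¬? (x ≟ᴬ y)) ys
        shorter  = filter-notAll (λ y → ¬? (x ≟ᴬ y)) ys (Any.map (λ x≡y x≢y → x≢y x≡y) x∈ys)
        z , z∈xs , z∉ys∖x = length<⇒∃∉ xs! ys∖x (≤-trans shorter ∣ys∣≤∣xs∣)
    in z , there z∈xs , λ z∈ys → z∉ys∖x (∈-filter⁺ (λ y → ¬? (x ≟ᴬ y)) z∈ys (All.lookup x≢xs z∈xs))

∣p∪q∣≤∣p∣+∣q∣ : (p q : Subset n) → ∣ p ∪ q ∣ ≤ ∣ p ∣ + ∣ q ∣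
∣p∪q∣≤∣p∣+∣q∣ []            []            = z≤n
∣p∪q∣≤∣p∣+∣q∣ (inside  ∷ p) (inside  ∷ q) rewrite +-suc ∣ p ∣ ∣ q ∣ = s≤s (m≤n⇒m≤1+n (∣p∪q∣≤∣p∣+∣q∣ p q))
∣p∪q∣≤∣p∣+∣q∣ (inside  ∷ p) (outside ∷ q) = s≤s (∣p∪q∣≤∣p∣+∣q∣ p q)
∣p∪q∣≤∣p∣+∣q∣ (outside ∷ p) (inside  ∷ q) rewrite +-suc ∣ p ∣ ∣ q ∣ = s≤s (∣p∪q∣≤∣p∣+∣q∣ p q)
∣p∪q∣≤∣p∣+∣q∣ (outside ∷ p) (outside ∷ q) = ∣p∪q∣≤∣p∣+∣q∣ p q

p⊆q∧∣q∣≤∣p∣⇒p≡q : {p q : Subset n} → p ⊆ q → ∣ q ∣ ≤ ∣ p ∣ → p ≡ q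
p⊆q∧∣q∣≤∣p∣⇒p≡q {p = []}          {[]}          _   _              = refl
p⊆q∧∣q∣≤∣p∣⇒p≡q {p = inside  ∷ p} {inside  ∷ q} p⊆q (s≤s ∣q∣≤∣p∣) =
  cong (inside ∷_) (p⊆q∧∣q∣≤∣p∣⇒p≡q (drop-∷-⊆ p⊆q) ∣q∣≤∣p∣)
p⊆q∧∣q∣≤∣p∣⇒p≡q {p = outside ∷ p} {outside ∷ q} p⊆q ∣q∣≤∣p∣       =
  cong (outside ∷_) (p⊆q∧∣q∣≤∣p∣⇒p≡q (drop-∷-⊆ p⊆q) ∣q∣≤∣p∣)
p⊆q∧∣q∣≤∣p∣⇒p≡q {p = outside ∷ p} {inside  ∷ q} p⊆q ∣q∣<∣p∣       =
  contradiction (≤-trans ∣q∣<∣p∣ (p⊆q⇒∣p∣≤∣q∣ (drop-∷-⊆ p⊆q))) (n≮n ∣ q ∣)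
p⊆q∧∣q∣≤∣p∣⇒p≡q {p = inside  ∷ p} {outside ∷ q} p⊆q _ with p⊆q here
... | ()

Empty[p∩∁q]⇒p⊆q : {p q : Subset n} → Empty (p ∩ ∁ q) → p ⊆ q
Empty[p∩∁q]⇒p⊆q {q = q} empty {x} x∈p with x ∈? q
... | yes x∈q = x∈q
... | no  x∉q = contradiction (x , x∈p∩q⁺ (x∈p , x∉p⇒x∈∁p x∉q)) empty

∣q∣≤∣p∣∧p≢q⇒Nonempty[p∩∁q] : {p q : Subset n} → ∣ q ∣ ≤ ∣ p ∣ → p ≢ q → Nonempty (p ∩ ∁ q)
∣q∣≤∣p∣∧p≢q⇒Nonempty[p∩∁q] {p = p} {q} ∣q∣≤∣p∣ p≢q with nonempty? (p ∩ ∁ q)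
... | yes nonempty = nonempty
... | no  empty    = contradiction (p⊆q∧∣q∣≤∣p∣⇒p≡q (Empty[p∩∁q]⇒p⊆q empty) ∣q∣≤∣p∣) p≢q

0<∣p∣⇒Nonempty : {p : Subset n} → 0 < ∣ p ∣ → Nonempty p
0<∣p∣⇒Nonempty {n} {p} 0<∣p∣ with nonempty? p
... | yes nonempty = nonempty
... | no  empty    = contradiction (trans (cong ∣_∣ (Empty-unique empty)) (∣⊥∣≡0 n)) (≢-sym (<⇒≢ 0<∣p∣))

∁-meets-no-smaller : {P : Subset n} {As : List (Subset n)} → P ∉ As → All (λ A → ∣ P ∣ ≤ ∣ A ∣) As →
                     All (λ A → Nonempty (A ∩ ∁ P)) As
∁-meets-no-smaller P∉As ∣P∣≤∣As∣ = All.tabulate λ A∈As →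
  ∣q∣≤∣p∣∧p≢q⇒Nonempty[p∩∁q] (All.lookup ∣P∣≤∣As∣ A∈As) (λ { refl → P∉As A∈As })

image : (Fin m → Fin n) → Subset m → Subset n
image f []            = ⊥
image f (inside  ∷ p) = ⁅ f zero ⁆ ∪ image (f ∘ suc) p
image f (outside ∷ p) = image (f ∘ suc) p

∣image∣≤∣p∣ : (f : Fin m → Fin n) (p : Subset m) → ∣ image f p ∣ ≤ ∣ p ∣
∣image∣≤∣p∣ {n = n} f [] = ≤-reflexive (∣⊥∣≡0 n)
∣image∣≤∣p∣ f (inside  ∷ p) =
  ≤-trans (∣p∪q∣≤∣p∣+∣q∣ ⁅ f zero ⁆ _) (+-mono-≤ (≤-reflexive (∣⁅x⁆∣≡1 (f zero))) (∣image∣≤∣p∣ (f ∘ suc) p))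
∣image∣≤∣p∣ f (outside ∷ p) = ∣image∣≤∣p∣ (f ∘ suc) p

x∈p⇒f[x]∈image : (f : Fin m → Fin n) {p : Subset m} {x : Fin m} → x ∈ₛ p → f x ∈ₛ image f p
x∈p⇒f[x]∈image f here                      = x∈p∪q⁺ (inj₁ (x∈⁅x⁆ (f zero)))
x∈p⇒f[x]∈image f {inside  ∷ _} (there x∈p) = x∈p∪q⁺ (inj₂ (x∈p⇒f[x]∈image (f ∘ suc) x∈p))
x∈p⇒f[x]∈image f {outside ∷ _} (there x∈p) = x∈p⇒f[x]∈image (f ∘ suc) x∈p

preimage : (Fin m → Fin n) → Subset n → Subset m
preimage f q = Vec.tabulate (λ x → Vec.lookup q (f x))

f[x]∈q⇒x∈preimage : (f : Fin m → Fin n) {q : Subset n} {x : Fin m} → f x ∈ₛ q → x ∈ₛ preimage f q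
f[x]∈q⇒x∈preimage f {q} {x} fx∈q =
  lookup⇒[]= x (preimage f q) (trans (lookup∘tabulate _ x) ([]=⇒lookup fx∈q))

x∈preimage⇒f[x]∈q : (f : Fin m → Fin n) {q : Subset n} {x : Fin m} → x ∈ₛ preimage f q → f x ∈ₛ q
x∈preimage⇒f[x]∈q f {q} {x} x∈f⁻¹q =
  lookup⇒[]= (f x) q (trans (sym (lookup∘tabulate _ x)) ([]=⇒lookup x∈f⁻¹q))

preimage-meets⇒meets-image : (f : Fin m → Fin n) {q : Subset n} {p : Subset m} →
                             Nonempty (preimage f q ∩ p) → Nonempty (q ∩ image f p)
preimage-meets⇒meets-image f {q} {p} (x , x∈f⁻¹q∩p) =
  let x∈f⁻¹q , x∈p = x∈p∩q⁻ (preimage f q) p x∈f⁻¹q∩p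
  in f x , x∈p∩q⁺ (x∈preimage⇒f[x]∈q f x∈f⁻¹q , x∈p⇒f[x]∈image f x∈p)

∣q∩p∣≤∣preimage∣ : (f : Fin m → Fin n) {p : Subset n} → (∀ {x} → x ∈ₛ p → ∃ λ i → f i ≡ x) →
                   (q : Subset n) → ∣ q ∩ p ∣ ≤ ∣ preimage f q ∣
∣q∩p∣≤∣preimage∣ f {p} onto q = ≤-trans (p⊆q⇒∣p∣≤∣q∣ q∩p⊆image) (∣image∣≤∣p∣ f (preimage f q))
  where
  q∩p⊆image : q ∩ p ⊆ image f (preimage f q)
  q∩p⊆image x∈q∩p with x∈q , x∈p ← x∈p∩q⁻ q p x∈q∩p with i , refl ← onto x∈p =
    x∈p⇒f[x]∈image f (f[x]∈q⇒x∈preimage f x∈q)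

enumerate : (p : Subset n) → Fin ∣ p ∣ → Fin n
enumerate (inside  ∷ p) zero    = zero
enumerate (inside  ∷ p) (suc i) = suc (enumerate p i)
enumerate (outside ∷ p) i       = suc (enumerate p i)

enumerate-∈ : (p : Subset n) (i : Fin ∣ p ∣) → enumerate p i ∈ₛ p
enumerate-∈ (inside  ∷ p) zero    = here
enumerate-∈ (inside  ∷ p) (suc i) = there (enumerate-∈ p i)
enumerate-∈ (outside ∷ p) i       = there (enumerate-∈ p i)

enumerate-surjective : (p : Subset n) {x : Fin n} → x ∈ₛ p → ∃ λ i → enumerate p i ≡ x
enumerate-surjective (inside  ∷ p) here        = zero , refl
enumerate-surjective (inside  ∷ p) (there x∈p) = let i , eq = enumerate-surjective p x∈p in suc i , cong suc eq
enumerate-surjective (outside ∷ p) (there x∈p) = let i , eq = enumerate-surjective p x∈p in i , cong suc eq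

enumeration : (p : Subset n) → ∣ p ∣ ≡ m →
              Σ (Fin m → Fin n) λ f → (∀ i → f i ∈ₛ p) × (∀ {x} → x ∈ₛ p → ∃ λ i → f i ≡ x)
enumeration p refl = enumerate p , enumerate-∈ p , enumerate-surjective p

pairs : List (Subset 5)
pairs = pair (# 0) (# 1) ∷ pair (# 0) (# 2) ∷ pair (# 0) (# 3) ∷ pair (# 0) (# 4) ∷ pair (# 1) (# 2)
      ∷ pair (# 1) (# 3) ∷ pair (# 1) (# 4) ∷ pair (# 2) (# 3) ∷ pair (# 2) (# 4) ∷ pair (# 3) (# 4) ∷ []
  where pair : Fin 5 → Fin 5 → Subset 5
        pair i j = ⁅ i ⁆ ∪ ⁅ j ⁆

-- Opaque: letting these decided facts unfold makes checking their users blow up.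
opaque
  pairs-unique : Unique pairs
  pairs-unique = from-yes (unique? (≡-dec Bool._≟_) pairs)

  pairs-size : All (λ P → ∣ P ∣ ≡ 2) pairs
  pairs-size = from-yes (all? (λ P → ∣ P ∣ ≟ 2) pairs)

three-transversal-Fin5 : (As : List (Subset 5)) → length As ≤ 9 → All (λ A → 2 ≤ ∣ A ∣) As →
                         ∃ λ T → ∣ T ∣ ≡ 3 × Nonempty T × All (λ A → Nonempty (A ∩ T)) As
three-transversal-Fin5 As ∣As∣≤9 2≤∣As∣ =
  let P , P∈pairs , P∉As = length<⇒∃∉ (≡-dec Bool._≟_) pairs-unique As (s≤s ∣As∣≤9)
      ∣P∣≡2  = All.lookup pairs-size P∈pairs
      ∣∁P∣≡3 = trans (∣∁p∣≡n∸∣p∣ P) (cong (5 ∸_) ∣P∣≡2)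
  in ∁ P , ∣∁P∣≡3 , 0<∣p∣⇒Nonempty (≤-trans (s≤s z≤n) (≤-reflexive (sym ∣∁P∣≡3)))
         , ∁-meets-no-smaller P∉As (All.map (≤-trans (≤-reflexive ∣P∣≡2)) 2≤∣As∣)

three-transversal-within-edge : (E : Subset n) (Fs : List (Subset n)) → ∣ E ∣ ≡ 5 → length Fs ≤ 9 →
                                All (λ F → 2 ≤ ∣ F ∩ E ∣) Fs →
                                ∃ λ C → ∣ C ∣ ≤ 3 × All (λ F → Nonempty (F ∩ C)) (E ∷ Fs)
three-transversal-within-edge E Fs ∣E∣≡5 ∣Fs∣≤9 2≤∣Fs∩E∣ =
  let f , f∈E , onto = enumeration E ∣E∣≡5
      2≤∣traces∣ = map⁺ (All.map (λ {F} 2≤∣F∩E∣ → ≤-trans 2≤∣F∩E∣ (∣q∩p∣≤∣preimage∣ f onto F)) 2≤∣Fs∩E∣)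
      ∣traces∣≤9 = ≤-trans (≤-reflexive (length-map (preimage f) Fs)) ∣Fs∣≤9
      T , ∣T∣≡3 , (t , t∈T) , T-meets = three-transversal-Fin5 (map (preimage f) Fs) ∣traces∣≤9 2≤∣traces∣
  in image f T , ≤-trans (∣image∣≤∣p∣ f T) (≤-reflexive ∣T∣≡3)
     , preimage-meets⇒meets-image f (t , x∈p∩q⁺ (f[x]∈q⇒x∈preimage f (f∈E t) , t∈T))
     ∷ All.map (preimage-meets⇒meets-image f) (map⁻ T-meets)

mainTheorem15 : ∀ (n : ℕ) (H : Hypergraph n) →
    Uniform 5 H → TwoIntersecting H → numEdges H ≤ 10 →
    CoveringNumberAtMost H 3
mainTheorem15 n record { edges = [] } _ _ _ = ⊥ , (λ _ ()) , ≤-trans (≤-reflexive (∣⊥∣≡0 n)) z≤n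
mainTheorem15 n record { edges = E ∷ Fs ; simple = E≢Fs ∷ _ } uniform twoIntersecting (s≤s ∣Fs∣≤9) =
  let C , ∣C∣≤3 , C-meets = three-transversal-within-edge E Fs (uniform E (here refl)) ∣Fs∣≤9
        (All.tabulate λ F∈Fs → twoIntersecting _ E (there F∈Fs) (here refl) (≢-sym (All.lookup E≢Fs F∈Fs)))
  in C , (λ _ → All.lookup C-meets) , ∣C∣≤3
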